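{- Let $G$ be a graph, $k$ a positive integer, $uv\in E(G)$, and $c$ a $k$-colouring of $G$ such that some colour $i\in[k]$ appears on no vertex of $N[u]\cup N[v]$ (the closed neighbourhoods of $u$ and $v$). Then there exist $c_u\in C_{c,u}$ and $c_v\in C_{c,v}$ which have no common neighbour in $\mathcal{C}_k(G)$ other than $c$.
   Context: A (proper) $k$-colouring of $G$ is a map $V(G)\to[k]$ giving adjacent vertices different colours. $\mathcal{C}_k(G)$ is the graph whose vertices are the $k$-colourings of $G$, two being adjacent iff they differ at exactly one vertex. For a $k$-colouring $c$ and a vertex $w$, $C_{c,w}$ is the set of $k$-colourings of $G$ that differ from $c$ exactly at $w$. -}

module Defs where

open import Data.Nat using (ℕ)
open import Data.Fin using (Fin)
open import Data.Product using (∃; _×_)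
open import Data.Sum using (_⊎_)
open import Data.Empty using (⊥)
open import Relation.Nullary using (¬_)
open import Relation.Binary.PropositionalEquality using (_≡_; _≢_)

record Graph : Set₁ where
  field
    n      : ℕ
    Adj    : Fin n → Fin n → Set
    sym    : ∀ {x y} → Adj x y → Adj y x
    irrefl : ∀ {x} → ¬ Adj x x

open Graph public

V : Graph → Set
V G = Fin (n G)

record Colouring (G : Graph) (k : ℕ) : Set where
  constructor colouring
  field
    col    : V G → Fin k
    proper : ∀ {x y} → Adj G x y → col x ≢ col y

open Colouring public

_≈_ : ∀ {G k} → Colouring G k → Colouring G k → Set
_≈_ {G} c d = ∀ (x : V G) → col c x ≡ col d x

DiffersExactlyAt : ∀ {G k} → Colouring G k → Colouring G k → V G → Set
DiffersExactlyAt {G} c d w = (col c w ≢ col d w) × (∀ (x : V G) → x ≢ w → col c x ≡ col d x)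

InC : ∀ {G k} → Colouring G k → V G → Colouring G k → Set
InC c w d = DiffersExactlyAt c d w

-- adjacency in the reconfiguration graph C_k(G): differ at exactly one vertex
AdjC : ∀ {G k} → Colouring G k → Colouring G k → Set
AdjC {G} c d = ∃ λ (w : V G) → DiffersExactlyAt c d w

InClosedNbhd : (G : Graph) → V G → V G → Set
InClosedNbhd G u x = (x ≡ u) ⊎ Adj G u x

-- Recolour u and v to the colour i missing from N[u] ∪ N[v]. A common neighbour d of
-- the two recolourings must change a vertex wherever they disagree, i.e. at both u
-- and v; so d either undoes both recolourings, and is c, or performs both, which
-- gives the adjacent vertices u and v the same colour i.
{-# OPTIONS --safe #-}
module Submission where

open import Defs hiding (sym)
open import Data.Nat using (ℕ; _≤_)
open import Data.Fin using (Fin; _≟_)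
open import Data.Vec.Functional using (updateAt)
open import Data.Vec.Functional.Properties using (updateAt-updates; updateAt-minimal)
open import Data.Product using (∃-syntax; _×_; _,_; proj₂)
open import Data.Sum using (_⊎_; inj₁; inj₂)
open import Function using (const; _∘_)
open import Relation.Nullary using (yes; no; contradiction)
open import Relation.Binary.PropositionalEquality
  using (_≡_; _≢_; refl; sym; trans; subst; module ≡-Reasoning)

distinct∈pair⇒same-pair : ∀ {a} {A : Set a} {u v w₁ w₂ : A} → u ≢ v →
  u ≡ w₁ ⊎ u ≡ w₂ → v ≡ w₁ ⊎ v ≡ w₂ → (w₁ ≡ u × w₂ ≡ v) ⊎ (w₁ ≡ v × w₂ ≡ u)
distinct∈pair⇒same-pair u≢v (inj₁ refl) (inj₁ refl) = contradiction refl u≢v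
distinct∈pair⇒same-pair u≢v (inj₁ refl) (inj₂ refl) = inj₁ (refl , refl)
distinct∈pair⇒same-pair u≢v (inj₂ refl) (inj₁ refl) = inj₂ (refl , refl)
distinct∈pair⇒same-pair u≢v (inj₂ refl) (inj₂ refl) = contradiction refl u≢v

module Reconfiguration (G : Graph) (k : ℕ) where

  FreeAt : Colouring G k → V G → Fin k → Set
  FreeAt c w a = ∀ y → Adj G w y → col c y ≢ a

  recolour : (c : Colouring G k) (w : V G) (a : Fin k) → FreeAt c w a → Colouring G k
  recolour c w a free = colouring recoloured proper′
    where
    recoloured : V G → Fin k
    recoloured = updateAt (col c) w (const a)

    here : recoloured w ≡ a
    here = updateAt-updates w (col c)

    there : ∀ {x} → x ≢ w → recoloured x ≡ col c x
    there {x} x≢w = updateAt-minimal x w (col c) x≢w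

    proper′ : ∀ {x y} → Adj G x y → recoloured x ≢ recoloured y
    proper′ {x} {y} xy with x ≟ w | y ≟ w
    ... | yes refl | yes refl = contradiction xy (irrefl G)
    ... | yes refl | no y≢w   = λ e → free y xy (trans (sym (there y≢w)) (trans (sym e) here))
    ... | no x≢w   | yes refl = λ e → free x (Graph.sym G xy) (trans (sym (there x≢w)) (trans e here))
    ... | no x≢w   | no y≢w   = λ e → proper c xy (trans (sym (there x≢w)) (trans e (there y≢w)))

  recolour-at : ∀ c w a (free : FreeAt c w a) → col (recolour c w a free) w ≡ a
  recolour-at c w a _ = updateAt-updates w (col c)

  recolour-differsExactlyAt : ∀ c w a (free : FreeAt c w a) → col c w ≢ a →
                              DiffersExactlyAt c (recolour c w a free) w
  recolour-differsExactlyAt c w a free c≢a =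
      (λ e → c≢a (trans e (recolour-at c w a free)))
    , (λ x x≢w → sym (updateAt-minimal x w (col c) x≢w))

  AgreeOff : Colouring G k → Colouring G k → V G → Set
  AgreeOff c d w = ∀ x → x ≢ w → col c x ≡ col d x

  agreeOff-trans : ∀ c d e {w} → AgreeOff c d w → AgreeOff d e w → AgreeOff c e w
  agreeOff-trans _ _ _ cd de x x≢w = trans (cd x x≢w) (de x x≢w)

  agreeOff-distinct⇒≈ : ∀ c d {u v} → u ≢ v → AgreeOff c d u → AgreeOff c d v → c ≈ d
  agreeOff-distinct⇒≈ _ _ {u} u≢v off-u off-v x with x ≟ u
  ... | yes refl = off-v x u≢v
  ... | no x≢u   = off-u x x≢u

  disagreement⇒changed : ∀ c d e {w₁ w₂ x} → AgreeOff c d w₁ → AgreeOff e d w₂ →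
                         col c x ≢ col e x → x ≡ w₁ ⊎ x ≡ w₂
  disagreement⇒changed _ _ _ {w₁} {w₂} {x} cd ed c≢e with x ≟ w₁ | x ≟ w₂
  ... | yes x≡w₁ | _        = inj₁ x≡w₁
  ... | no _     | yes x≡w₂ = inj₂ x≡w₂
  ... | no x≢w₁  | no x≢w₂  = contradiction (trans (cd x x≢w₁) (sym (ed x x≢w₂))) c≢e

  differsExactlyAt-disagree : ∀ (c cᵤ cᵥ : Colouring G k) {u v} → u ≢ v →
    DiffersExactlyAt c cᵤ u → DiffersExactlyAt c cᵥ v → col cᵤ u ≢ col cᵥ u
  differsExactlyAt-disagree _ _ _ {u} u≢v (c≢cᵤ , _) (_ , cᵥ-off) e =
    c≢cᵤ (trans (cᵥ-off u u≢v) (sym e))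

  commonNeighbour⇒≈⊎both-recoloured : ∀ (c cᵤ cᵥ d : Colouring G k) {u v} → u ≢ v →
    DiffersExactlyAt c cᵤ u → DiffersExactlyAt c cᵥ v → AdjC cᵤ d → AdjC cᵥ d →
    d ≈ c ⊎ (col cᵤ u ≡ col d u × col cᵥ v ≡ col d v)
  commonNeighbour⇒≈⊎both-recoloured c cᵤ cᵥ d {u} {v} u≢v cᵤ∈C cᵥ∈C (w₁ , _ , cᵤd) (w₂ , _ , cᵥd)
    with distinct∈pair⇒same-pair u≢v u-changed v-changed
    where
    u-changed : u ≡ w₁ ⊎ u ≡ w₂
    u-changed = disagreement⇒changed cᵤ d cᵥ cᵤd cᵥd
                  (differsExactlyAt-disagree c cᵤ cᵥ u≢v cᵤ∈C cᵥ∈C)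

    v-changed : v ≡ w₁ ⊎ v ≡ w₂
    v-changed = disagreement⇒changed cᵤ d cᵥ cᵤd cᵥd
                  (differsExactlyAt-disagree c cᵥ cᵤ (u≢v ∘ sym) cᵥ∈C cᵤ∈C ∘ sym)
  ... | inj₁ (refl , refl) =
    inj₁ (λ x → sym (agreeOff-distinct⇒≈ c d u≢v (agreeOff-trans c cᵤ d (proj₂ cᵤ∈C) cᵤd)
                                                 (agreeOff-trans c cᵥ d (proj₂ cᵥ∈C) cᵥd) x))
  ... | inj₂ (refl , refl) = inj₂ (cᵤd u u≢v , cᵥd v (u≢v ∘ sym))

lemma2p3 : (G : Graph) (k : ℕ) → 1 ≤ k → (u v : V G) → Adj G u v →
    (c : Colouring G k) →
    (∃[ i ] (∀ (x : V G) → InClosedNbhd G u x ⊎ InClosedNbhd G v x → col c x ≢ i)) →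
    ∃[ cu ] ∃[ cv ] (InC c u cu × InC c v cv ×
      (∀ (d : Colouring G k) → AdjC cu d → AdjC cv d → d ≈ c))
lemma2p3 G k _ u v uv c (i , i-absent) = cᵤ , cᵥ , cᵤ∈C , cᵥ∈C , commonNeighbour≈c
  where
  open Reconfiguration G k

  u≢v : u ≢ v
  u≢v u≡v = irrefl G (subst (Adj G u) (sym u≡v) uv)

  freeᵤ : FreeAt c u i
  freeᵤ y uy = i-absent y (inj₁ (inj₂ uy))

  freeᵥ : FreeAt c v i
  freeᵥ y vy = i-absent y (inj₂ (inj₂ vy))

  cᵤ cᵥ : Colouring G k
  cᵤ = recolour c u i freeᵤ
  cᵥ = recolour c v i freeᵥ

  cᵤ∈C : InC c u cᵤ
  cᵤ∈C = recolour-differsExactlyAt c u i freeᵤ (i-absent u (inj₁ (inj₁ refl)))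

  cᵥ∈C : InC c v cᵥ
  cᵥ∈C = recolour-differsExactlyAt c v i freeᵥ (i-absent v (inj₂ (inj₁ refl)))

  commonNeighbour≈c : ∀ d → AdjC cᵤ d → AdjC cᵥ d → d ≈ c
  commonNeighbour≈c d cᵤ~d cᵥ~d
    with commonNeighbour⇒≈⊎both-recoloured c cᵤ cᵥ d u≢v cᵤ∈C cᵥ∈C cᵤ~d cᵥ~d
  ... | inj₁ d≈c               = d≈c
  ... | inj₂ (cᵤu≡du , cᵥv≡dv) = contradiction du≡dv (proper d uv)
    where
    open ≡-Reasoning
    du≡dv : col d u ≡ col d v
    du≡dv = begin
      col d u   ≡⟨ sym cᵤu≡du ⟩
      col cᵤ u  ≡⟨ recolour-at c u i freeᵤ ⟩
      i         ≡⟨ sym (recolour-at c v i freeᵥ) ⟩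
      col cᵥ v  ≡⟨ cᵥv≡dv ⟩
      col d v   ∎
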